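{- Let $G$ be a finite, simple, connected graph containing a cycle of length $\ell\geq 3$. Then for every $t\in\{1,\ldots,\ell\}$, $\chi_t(G)\leq\gcd(t,\ell)$.
   Context: All graphs are finite, simple and connected. A cycle of length $\ell$ is a sequence of $\ell$ distinct vertices $v_1,\dots,v_\ell$ with $v_j\sim v_{j+1}$ and $v_\ell\sim v_1$. A path of length $t$ is a sequence $v_1,\ldots,v_{t+1}$ of distinct vertices with $v_j\sim v_{j+1}$ for all $j$; its endpoints are $v_1$ and $v_{t+1}$. A (not necessarily proper) colouring of the vertices of $G$ is $t$-periodic if every path of length $t$ in $G$ has endpoints of the same colour. The vertex $t$-periodic colouring number $\chi_t(G)$ is the largest $k$ such that $G$ has a $t$-periodic colouring of the vertices using exactly $k$ colours. -}

module Defs where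

open import Data.Nat using (ℕ; zero; suc; _≤_)
open import Data.Fin using (Fin; zero; suc; inject₁; fromℕ; toℕ)
open import Relation.Binary.PropositionalEquality using (_≡_)
open import Relation.Nullary using (¬_)
open import Function.Definitions using (Injective; Surjective)

record SimpleGraph (n : ℕ) : Set₁ where
  field
    _∼_      : Fin n → Fin n → Set
    irrefl   : ∀ {u} → ¬ (u ∼ u)
    sym      : ∀ {u v} → u ∼ v → v ∼ u

open SimpleGraph public

data Walk {n : ℕ} (G : SimpleGraph n) : Fin n → Fin n → Set where
  here : ∀ {u} → Walk G u u
  step : ∀ {u w v} → _∼_ G u w → Walk G w v → Walk G u v

Connected : ∀ {n} → SimpleGraph n → Set
Connected G = ∀ u v → Walk G u v

record Path {n : ℕ} (G : SimpleGraph n) (t : ℕ) : Set where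
  field
    vert : Fin (suc t) → Fin n
    inj  : Injective _≡_ _≡_ vert
    adj  : ∀ (i : Fin t) → _∼_ G (vert (inject₁ i)) (vert (suc i))

record Cycle {n : ℕ} (G : SimpleGraph n) (ℓ : ℕ) : Set where
  field
    vert  : Fin ℓ → Fin n
    inj   : Injective _≡_ _≡_ vert
    adj   : ∀ (i j : Fin ℓ) → suc (toℕ i) ≡ toℕ j → _∼_ G (vert i) (vert j)
    close : ∀ (i j : Fin ℓ) → suc (toℕ i) ≡ ℓ → toℕ j ≡ 0 → _∼_ G (vert i) (vert j)

Periodic : ∀ {n k} → SimpleGraph n → ℕ → (Fin n → Fin k) → Set
Periodic G t c = ∀ (P : Path G t) → c (Path.vert P zero) ≡ c (Path.vert P (fromℕ t))

-- "χ_t(G) ≤ m": every t-periodic colouring using exactly k colours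
-- (i.e. surjective onto Fin k) has k ≤ m.
χ≤ : ∀ {n} → SimpleGraph n → ℕ → ℕ → Set
χ≤ G t m = ∀ (k : ℕ) (c : Fin _ → Fin k) → Surjective _≡_ _≡_ c → Periodic G t c → k ≤ m

{-# OPTIONS --safe #-}
-- For t < ℓ any t + 1 consecutive vertices of the cycle form a path, so the colouring
-- is t-periodic along the cycle; it is also ℓ-periodic, hence gcd(t, ℓ)-periodic by
-- Bézout, and at most gcd(t, ℓ) colours occur on the cycle.  A vertex x off the cycle
-- has a path meeting the cycle only at its end; continued t − 1 steps along the cycle
-- it is still a path, whose vertex at distance t from x has the colour of x and is on
-- the cycle or closer to it.  By induction every colour occurs on the cycle.
module Submission where

open import Defs
open import Data.Nat using (ℕ; _≤_)
open import Data.Nat.GCD using (gcd)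

open import Data.Nat.Base
  using (zero; suc; _+_; _*_; _∸_; _<_; NonZero; ≢-nonZero; >-nonZero; z≤n; s≤s; z<s; s≤s⁻¹)
open import Data.Nat.Properties
open import Data.Nat.DivMod
  using (_%_; _/_; _mod_; m≡m%n+[m/n]*n; [m+kn]%n≡m%n; [m+n]%n≡m%n; m<n⇒m%n≡m; n%n≡0; m%n<n)
open import Data.Nat.Divisibility using (_∣_; divides; >⇒∤)
open import Data.Nat.GCD using (gcd-GCD; gcd[m,n]≢0; module Bézout)
open import Data.Nat.Induction using (<-rec)
open import Data.Fin using (Fin; toℕ; fromℕ<)
import Data.Fin.Properties as Fin
open import Data.Product using (∃; _,_; proj₁; proj₂)
open import Data.Sum using (inj₁; inj₂; [_,_]′)
open import Relation.Nullary using (¬_; Dec; yes; no; contradiction)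
open import Relation.Binary.PropositionalEquality
  using (_≡_; _≢_; refl; trans; cong; cong₂; subst; module ≡-Reasoning)
  renaming (sym to ≡-sym)
open import Function.Base using (_∘_)
open import Function.Definitions using (StrictlySurjective)
open import Function.Consequences.Propositional using (surjective⇒strictlySurjective)

open ≡-Reasoning

[m+n]%o≡m%o⇒o∣n : ∀ m n o .{{_ : NonZero o}} → (m + n) % o ≡ m % o → o ∣ n
[m+n]%o≡m%o⇒o∣n m n o eq = divides (q₁ ∸ q₀) (begin
  n                                       ≡⟨ m+n∸m≡n m n ⟨
  m + n ∸ m                               ≡⟨ cong₂ _∸_ (m≡m%n+[m/n]*n (m + n) o) (m≡m%n+[m/n]*n m o) ⟩
  (m + n) % o + q₁ * o ∸ (m % o + q₀ * o) ≡⟨ cong (λ r → r + q₁ * o ∸ (m % o + q₀ * o)) eq ⟩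
  m % o + q₁ * o ∸ (m % o + q₀ * o)       ≡⟨ [m+n]∸[m+o]≡n∸o (m % o) (q₁ * o) (q₀ * o) ⟩
  q₁ * o ∸ q₀ * o                         ≡⟨ *-distribʳ-∸ o q₁ q₀ ⟨
  (q₁ ∸ q₀) * o                           ∎)
  where
  q₁ q₀ : ℕ
  q₁ = (m + n) / o
  q₀ = m / o

m∣n∧n<m⇒n≡0 : ∀ {m n} → m ∣ n → n < m → n ≡ 0
m∣n∧n<m⇒n≡0 {n = zero}  _   _   = refl
m∣n∧n<m⇒n≡0 {n = suc _} m∣n n<m = contradiction m∣n (>⇒∤ n<m)

+-%-cancelˡ : ∀ p o .{{_ : NonZero o}} {a b} → a < o → b < o → (p + a) % o ≡ (p + b) % o → a ≡ b
+-%-cancelˡ p o {a} {b} a<o b<o eq =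
  [ (λ a≤b → ordered a≤b b<o eq) , (λ b≤a → ≡-sym (ordered b≤a a<o (≡-sym eq))) ]′ (≤-total a b)
  where
  ordered : ∀ {a b} → a ≤ b → b < o → (p + a) % o ≡ (p + b) % o → a ≡ b
  ordered {a} {b} a≤b b<o eq = begin
    a               ≡⟨ +-identityʳ a ⟨
    a + 0           ≡⟨ cong (a +_) difference≡0 ⟨
    a + (b ∸ a)     ≡⟨ m+[n∸m]≡n a≤b ⟩
    b               ∎
    where
    difference≡0 : b ∸ a ≡ 0
    difference≡0 = m∣n∧n<m⇒n≡0
      ([m+n]%o≡m%o⇒o∣n (p + a) (b ∸ a) o
        (trans (cong (_% o) (trans (+-assoc p a (b ∸ a)) (cong (p +_) (m+[n∸m]≡n a≤b)))) (≡-sym eq)))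
      (≤-<-trans (m∸n≤m b a) b<o)

strictlySurjective⇒≤ : ∀ {m k} {f : Fin m → Fin k} → StrictlySurjective _≡_ f → k ≤ m
strictlySurjective⇒≤ {f = f} surj = Fin.injective⇒≤ {f = proj₁ ∘ surj} λ {y} {y′} eq →
  trans (≡-sym (proj₂ (surj y))) (trans (cong f eq) (proj₂ (surj y′)))

suc-% : ∀ m n .{{_ : NonZero n}} → suc m % n ≡ suc (m % n) % n
suc-% m n = begin
  suc m % n                   ≡⟨ cong (λ r → suc r % n) (m≡m%n+[m/n]*n m n) ⟩
  suc (m % n + m / n * n) % n ≡⟨ [m+kn]%n≡m%n (suc (m % n)) (m / n) n ⟩
  suc (m % n) % n             ∎

module _ {a} {A : Set a} (f : ℕ → A) where

  Period : ℕ → Set a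
  Period p = ∀ m → f (m + p) ≡ f m

  period-* : ∀ {p} → Period p → ∀ j → Period (j * p)
  period-* {p} per zero    m = cong f (+-identityʳ m)
  period-* {p} per (suc j) m = begin
    f (m + (p + j * p)) ≡⟨ cong f (trans (cong (m +_) (+-comm p (j * p))) (≡-sym (+-assoc m (j * p) p))) ⟩
    f (m + j * p + p)   ≡⟨ per (m + j * p) ⟩
    f (m + j * p)       ≡⟨ period-* per j m ⟩
    f m                 ∎

  period-bézout : ∀ {p q d} → Period p → Period q → ∀ x y → d + y * q ≡ x * p → Period d
  period-bézout {p} {q} {d} per-p per-q x y eq m = begin
    f (m + d)         ≡⟨ period-* per-q y (m + d) ⟨
    f (m + d + y * q) ≡⟨ cong f (trans (+-assoc m d (y * q)) (cong (m +_) eq)) ⟩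
    f (m + x * p)     ≡⟨ period-* per-p x m ⟩
    f m               ∎

  period-gcd : ∀ {p q} → Period p → Period q → Period (gcd p q)
  period-gcd {p} {q} per-p per-q with Bézout.identity (gcd-GCD p q)
  ... | Bézout.+- x y eq = period-bézout per-p per-q x y eq
  ... | Bézout.-+ x y eq = period-bézout per-q per-p y x eq

  period-% : ∀ {p} .{{_ : NonZero p}} → Period p → ∀ m → f m ≡ f (m % p)
  period-% {p} per m = begin
    f m                   ≡⟨ cong f (m≡m%n+[m/n]*n m p) ⟩
    f (m % p + m / p * p) ≡⟨ period-* per (m / p) (m % p) ⟩
    f (m % p)             ∎

module _ {a} {A : Set a} where

  Injective≤ : (ℕ → A) → ℕ → Set a
  Injective≤ f d = ∀ {i j} → i ≤ d → j ≤ d → f i ≡ f j → i ≡ j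

  Injective≤-mono : ∀ {f d e} → e ≤ d → Injective≤ f d → Injective≤ f e
  Injective≤-mono e≤d inj i≤e j≤e = inj (≤-trans i≤e e≤d) (≤-trans j≤e e≤d)

  shift-injective : ∀ {f} j {d} → Injective≤ f (j + d) → Injective≤ (λ i → f (j + i)) d
  shift-injective j inj {i} {i′} i≤d i′≤d eq =
    +-cancelˡ-≡ j i i′ (inj (+-monoʳ-≤ j i≤d) (+-monoʳ-≤ j i′≤d) eq)

  cons : A → (ℕ → A) → ℕ → A
  cons x f zero    = x
  cons x f (suc i) = f i

  cons-injective : ∀ {x f d} → (∀ {i} → i ≤ d → f i ≢ x) → Injective≤ f d → Injective≤ (cons x f) (suc d)
  cons-injective x∉f inj {zero}  {zero}  _         _         _  = refl
  cons-injective x∉f inj {zero}  {suc j} _         (s≤s j≤d) eq = contradiction (≡-sym eq) (x∉f j≤d)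
  cons-injective x∉f inj {suc i} {zero}  (s≤s i≤d) _         eq = contradiction eq (x∉f i≤d)
  cons-injective x∉f inj {suc i} {suc j} (s≤s i≤d) (s≤s j≤d) eq = cong suc (inj i≤d j≤d eq)

module _ {n} (G : SimpleGraph n) where

  Adjacent : (ℕ → Fin n) → ℕ → Set
  Adjacent f d = ∀ {i} → i < d → _∼_ G (f i) (f (suc i))

  Adjacent-mono : ∀ {f d e} → e ≤ d → Adjacent f d → Adjacent f e
  Adjacent-mono e≤d adj i<e = adj (<-≤-trans i<e e≤d)

  shift-adjacent : ∀ {f} j {d} → Adjacent f (j + d) → Adjacent (λ i → f (j + i)) d
  shift-adjacent {f} j adj {i} i<d =
    subst (λ k → _∼_ G (f (j + i)) (f k)) (≡-sym (+-suc j i)) (adj (+-monoʳ-< j i<d))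

  cons-adjacent : ∀ {x f d} → _∼_ G x (f 0) → Adjacent f d → Adjacent (cons x f) (suc d)
  cons-adjacent x∼f₀ adj {zero}  _         = x∼f₀
  cons-adjacent x∼f₀ adj {suc i} (s≤s i<d) = adj i<d

  sequencePath : ∀ {f t} → Adjacent f t → Injective≤ f t → Path G t
  sequencePath {f} {t} adj inj = record
    { vert = f ∘ toℕ
    ; inj  = λ {i} {j} eq → Fin.toℕ-injective (inj (Fin.toℕ≤pred[n] i) (Fin.toℕ≤pred[n] j) eq)
    ; adj  = λ i → subst (λ k → _∼_ G (f k) (f (suc (toℕ i)))) (≡-sym (Fin.toℕ-inject₁ i))
                         (adj (Fin.toℕ<n i))
    }

  periodic-ends : ∀ {k t} (c : Fin n → Fin k) {f} → Periodic G t c →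
                  Adjacent f t → Injective≤ f t → c (f 0) ≡ c (f t)
  periodic-ends {t = t} c {f} per adj inj =
    subst (λ k → c (f 0) ≡ c (f k)) (Fin.toℕ-fromℕ t) (per (sequencePath adj inj))

module Around {n} {G : SimpleGraph n} {ℓ} .{{_ : NonZero ℓ}} (C : Cycle G ℓ) where

  around : ℕ → Fin n
  around m = Cycle.vert C (m mod ℓ)

  toℕ-mod : ∀ m → toℕ (m mod ℓ) ≡ m % ℓ
  toℕ-mod m = Fin.toℕ-fromℕ< (m%n<n m ℓ)

  around-cong : ∀ {m m′} → m % ℓ ≡ m′ % ℓ → around m ≡ around m′
  around-cong {m} {m′} eq =
    cong (Cycle.vert C) (Fin.toℕ-injective (trans (toℕ-mod m) (trans eq (≡-sym (toℕ-mod m′)))))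

  around-toℕ : ∀ i → around (toℕ i) ≡ Cycle.vert C i
  around-toℕ i = cong (Cycle.vert C) (Fin.toℕ-injective (trans (toℕ-mod (toℕ i)) (m<n⇒m%n≡m (Fin.toℕ<n i))))

  around-period : Period around ℓ
  around-period m = around-cong ([m+n]%n≡m%n m ℓ)

  around-adjacent : ∀ m → _∼_ G (around m) (around (suc m))
  around-adjacent m with m≤n⇒m<n∨m≡n (m%n<n m ℓ)
  ... | inj₁ 1+r<ℓ = Cycle.adj C (m mod ℓ) (suc m mod ℓ) (begin
    suc (toℕ (m mod ℓ)) ≡⟨ cong suc (toℕ-mod m) ⟩
    suc (m % ℓ)         ≡⟨ m<n⇒m%n≡m 1+r<ℓ ⟨
    suc (m % ℓ) % ℓ     ≡⟨ suc-% m ℓ ⟨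
    suc m % ℓ           ≡⟨ toℕ-mod (suc m) ⟨
    toℕ (suc m mod ℓ)   ∎)
  ... | inj₂ 1+r≡ℓ = Cycle.close C (m mod ℓ) (suc m mod ℓ) (trans (cong suc (toℕ-mod m)) 1+r≡ℓ) (begin
    toℕ (suc m mod ℓ) ≡⟨ toℕ-mod (suc m) ⟩
    suc m % ℓ         ≡⟨ suc-% m ℓ ⟩
    suc (m % ℓ) % ℓ   ≡⟨ cong (_% ℓ) 1+r≡ℓ ⟩
    ℓ % ℓ             ≡⟨ n%n≡0 ℓ ⟩
    0                 ∎)

  arc-adjacent : ∀ p {d} → Adjacent G (λ j → around (p + j)) d
  arc-adjacent p {i = j} _ =
    subst (λ k → _∼_ G (around (p + j)) (around k)) (≡-sym (+-suc p j)) (around-adjacent (p + j))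

  arc-injective : ∀ p {d} → d < ℓ → Injective≤ (λ j → around (p + j)) d
  arc-injective p d<ℓ {j} {j′} j≤d j′≤d eq = +-%-cancelˡ p ℓ (≤-<-trans j≤d d<ℓ) (≤-<-trans j′≤d d<ℓ)
    (trans (≡-sym (toℕ-mod (p + j))) (trans (cong toℕ (Cycle.inj C eq)) (toℕ-mod (p + j′))))

module _ {n} {G : SimpleGraph n} {ℓ} .{{_ : NonZero ℓ}} (C : Cycle G ℓ) where

  open Around C

  OnCycle : Fin n → Set
  OnCycle v = ∃ λ i → v ≡ Cycle.vert C i

  onCycle? : ∀ v → Dec (OnCycle v)
  onCycle? v = Fin.any? (λ i → v Fin.≟ Cycle.vert C i)

  record Approach (s stem : ℕ) (x : Fin n) : Set where
    field
      vert      : ℕ → Fin n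
      start     : vert 0 ≡ x
      entry     : ℕ
      arc       : ∀ {j} → j ≤ s → vert (stem + j) ≡ around (entry + j)
      offCycle  : ∀ {i} → i < stem → ¬ OnCycle (vert i)
      adjacent  : Adjacent G vert (stem + s)
      injective : Injective≤ vert (stem + s)

  module _ {s : ℕ} where

    onCycle-approach : ∀ {x} → s < ℓ → OnCycle x → Approach s 0 x
    onCycle-approach s<ℓ (i , x≡i) = record
      { vert      = λ j → around (toℕ i + j)
      ; start     = trans (cong around (+-identityʳ (toℕ i))) (trans (around-toℕ i) (≡-sym x≡i))
      ; entry     = toℕ i
      ; arc       = λ _ → refl
      ; offCycle  = λ ()
      ; adjacent  = arc-adjacent (toℕ i)
      ; injective = arc-injective (toℕ i) s<ℓ
      }

    drop : ∀ {stem x} (A : Approach s stem x) {j} → j ≤ stem → Approach s (stem ∸ j) (Approach.vert A j)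
    drop {stem} A {j} j≤stem = record
      { vert      = λ i → vert (j + i)
      ; start     = cong vert (+-identityʳ j)
      ; entry     = entry
      ; arc       = λ {k} k≤s → trans (cong vert (j+[stem∸j+k]≡stem+k k)) (arc k≤s)
      ; offCycle  = λ i<stem∸j → offCycle (subst (_ <_) (m+[n∸m]≡n j≤stem) (+-monoʳ-< j i<stem∸j))
      ; adjacent  = shift-adjacent G j (subst (Adjacent G vert) (≡-sym (j+[stem∸j+k]≡stem+k s)) adjacent)
      ; injective = shift-injective j (subst (Injective≤ vert) (≡-sym (j+[stem∸j+k]≡stem+k s)) injective)
      }
      where
      open Approach A
      j+[stem∸j+k]≡stem+k : ∀ k → j + (stem ∸ j + k) ≡ stem + k
      j+[stem∸j+k]≡stem+k k = trans (≡-sym (+-assoc j (stem ∸ j) k)) (cong (_+ k) (m+[n∸m]≡n j≤stem))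

    onCycle-beyond-stem : ∀ {stem x} (A : Approach s stem x) {j} →
                          stem ≤ j → j ≤ stem + s → OnCycle (Approach.vert A j)
    onCycle-beyond-stem {stem} A {j} stem≤j j≤stem+s =
      (entry + (j ∸ stem)) mod ℓ ,
      trans (cong vert (≡-sym (m+[n∸m]≡n stem≤j))) (arc (m≤n+o⇒m∸n≤o j stem j≤stem+s))
      where open Approach A

    cons-approach : ∀ {stem x y} → ¬ OnCycle x → _∼_ G x y → (A : Approach s stem y) →
                    (∀ {i} → i ≤ stem + s → Approach.vert A i ≢ x) → Approach s (suc stem) x
    cons-approach {x = x} x∉C x∼y A x∉A = record
      { vert      = cons x vert
      ; start     = refl
      ; entry     = entry
      ; arc       = arc
      ; offCycle  = λ { {zero} _ → x∉C ; {suc i} (s≤s i<stem) → offCycle i<stem }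
      ; adjacent  = cons-adjacent G (subst (_∼_ G x) (≡-sym start) x∼y) adjacent
      ; injective = cons-injective x∉A injective
      }
      where open Approach A

    extend : ∀ {stem x y} → ¬ OnCycle x → _∼_ G x y → Approach s stem y → ∃ λ stem′ → Approach s stem′ x
    extend {stem} {x} x∉C x∼y A with Fin.any? (λ (i : Fin (suc (stem + s))) → Approach.vert A (toℕ i) Fin.≟ x)
    ... | no x∉A = suc stem , cons-approach x∉C x∼y A λ i≤ vᵢ≡x →
                     x∉A (fromℕ< (s≤s i≤) , trans (cong (Approach.vert A) (Fin.toℕ-fromℕ< (s≤s i≤))) vᵢ≡x)
    ... | yes (i , vᵢ≡x) with toℕ i ≤? stem
    ...   | yes i≤stem = stem ∸ toℕ i , subst (Approach s (stem ∸ toℕ i)) vᵢ≡x (drop A i≤stem)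
    ...   | no  i≰stem = contradiction (subst OnCycle vᵢ≡x
                           (onCycle-beyond-stem A (≰⇒≥ i≰stem) (Fin.toℕ≤pred[n] i))) x∉C

    approach : ∀ {x y} → s < ℓ → Walk G x y → OnCycle y → ∃ λ stem → Approach s stem x
    approach s<ℓ here y∈C = 0 , onCycle-approach s<ℓ y∈C
    approach {x} s<ℓ (step x∼z z⇝y) y∈C with onCycle? x
    ... | yes x∈C = 0 , onCycle-approach s<ℓ x∈C
    ... | no  x∉C = extend x∉C x∼z (proj₂ (approach s<ℓ z⇝y y∈C))

  module _ {k s} (c : Fin n → Fin k) (s<ℓ : s < ℓ) (per : Periodic G (suc s) c) where

    CycleColoured : Fin n → Set
    CycleColoured x = ∃ λ q → c x ≡ c (around q)

    approach-ends : ∀ {stem x} (A : Approach s stem x) → 0 < stem → c x ≡ c (Approach.vert A (suc s))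
    approach-ends {stem} A 0<stem = trans (cong c (≡-sym start))
      (periodic-ends G c per (Adjacent-mono G t≤len adjacent) (Injective≤-mono t≤len injective))
      where
      open Approach A
      t≤len : suc s ≤ stem + s
      t≤len = +-monoˡ-≤ s 0<stem

    approach-colour : ∀ stem {x} → Approach s stem x → CycleColoured x
    approach-colour = <-rec (λ stem → ∀ {x} → Approach s stem x → CycleColoured x) shorten
      where
      shorten : ∀ stem → (∀ {stem′} → stem′ < stem → ∀ {x} → Approach s stem′ x → CycleColoured x) →
                ∀ {x} → Approach s stem x → CycleColoured x
      shorten zero    _   A =
        Approach.entry A + 0 , cong c (trans (≡-sym (Approach.start A)) (Approach.arc A z≤n))
      shorten (suc d) rec A with suc s ≤? suc d
      ... | yes t≤stem = let q , e = rec (s≤s (m∸n≤m d s)) (drop A t≤stem) in q , trans (approach-ends A z<s) e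
      ... | no  t≰stem = entry + (s ∸ d) , trans (approach-ends A z<s) (cong c vₜ-on-arc)
        where
        open Approach A
        d≤s : d ≤ s
        d≤s = s≤s⁻¹ (<⇒≤ (≰⇒> t≰stem))
        vₜ-on-arc : vert (suc s) ≡ around (entry + (s ∸ d))
        vₜ-on-arc = trans (cong (vert ∘ suc) (≡-sym (m+[n∸m]≡n d≤s))) (arc (m∸n≤m s d))

    cycle-colour-period : Period (c ∘ around) (suc s)
    cycle-colour-period m with m≤n⇒m<n∨m≡n s<ℓ
    ... | inj₁ t<ℓ = ≡-sym (trans (cong (c ∘ around) (≡-sym (+-identityʳ m)))
                                  (periodic-ends G c per (arc-adjacent m) (arc-injective m t<ℓ)))
    ... | inj₂ t≡ℓ = cong c (trans (cong (λ p → around (m + p)) t≡ℓ) (around-period m))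

    instance
      gcd≢0 : NonZero (gcd (suc s) ℓ)
      gcd≢0 = ≢-nonZero (gcd[m,n]≢0 (suc s) ℓ (inj₁ λ ()))

    cycleColoured : Connected G → ∀ x → CycleColoured x
    cycleColoured connected x = approach-colour _ (proj₂ (approach s<ℓ (connected x (around 0)) (0 mod ℓ , refl)))

    colour-below-gcd : Connected G → ∀ x → ∃ λ (r : Fin (gcd (suc s) ℓ)) → c x ≡ c (around (toℕ r))
    colour-below-gcd connected x with cycleColoured connected x
    ... | q , cx≡cq = fromℕ< (m%n<n q _) , (begin
      c x                            ≡⟨ cx≡cq ⟩
      c (around q)                   ≡⟨ period-% (c ∘ around) gcd-period q ⟩
      c (around (q % gcd (suc s) ℓ)) ≡⟨ cong (c ∘ around) (Fin.toℕ-fromℕ< (m%n<n q _)) ⟨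
      c (around (toℕ (fromℕ< _)))    ∎)
      where
      gcd-period : Period (c ∘ around) (gcd (suc s) ℓ)
      gcd-period = period-gcd (c ∘ around) cycle-colour-period (λ m → cong c (around-period m))

    colours≤gcd : Connected G → StrictlySurjective _≡_ c → k ≤ gcd (suc s) ℓ
    colours≤gcd connected c-onto = strictlySurjective⇒≤ {f = c ∘ around ∘ toℕ} λ y →
      let r , cx≡cr = colour-below-gcd connected (proj₁ (c-onto y))
      in r , trans (≡-sym cx≡cr) (proj₂ (c-onto y))

corollary4p6 : ∀ {n : ℕ} (G : SimpleGraph n) → Connected G → (ℓ : ℕ) → 3 ≤ ℓ → Cycle G ℓ →
    ∀ (t : ℕ) → 1 ≤ t → t ≤ ℓ → χ≤ G t (gcd t ℓ)
corollary4p6 G connected ℓ 3≤ℓ C (suc s) _ t≤ℓ k c c-onto periodic =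
  colours≤gcd C c t≤ℓ periodic connected (surjective⇒strictlySurjective c-onto)
  where
  instance
    ℓ≢0 : NonZero ℓ
    ℓ≢0 = >-nonZero (≤-trans (s≤s z≤n) 3≤ℓ)
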